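{- For every $v=8\ell$ with $\ell\in\{1,2,3,\dots\}$, there exists a $3$-way $3$-homogeneous $(v,3,2)$ Steiner trade of volume $v$.
   Context: Let $V$ be a finite set with $v$ elements and let $t<k<v$ be positive integers. A $\mu$-way $(v,k,t)$ trade $T=\{T_1,\dots,T_\mu\}$ of volume $m$ consists of $\mu$ pairwise disjoint collections $T_1,\dots,T_\mu$, each of $m$ blocks ($k$-subsets of $V$), such that every $t$-subset of $V$ is contained in the same number of blocks in each $T_i$. The foundation $\mathrm{found}(T)$ is the set of elements covered by the blocks. It is a Steiner trade if every $t$-subset of $\mathrm{found}(T)$ is in at most one block of each $T_i$, and $d$-homogeneous if every element of $V$ lies in exactly $d$ blocks of each $T_i$. -}

module Defs where

open import Data.Nat using (ℕ; zero; suc; _*_; _≤_)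
open import Data.Fin using (Fin; _<_)
open import Data.Fin.Properties using (_≟_)
open import Data.Product using (_×_; _,_; ∃-syntax)
open import Data.Sum using (_⊎_)
open import Data.List using (List; []; _∷_; length)
open import Data.List.Relation.Unary.All using (All)
open import Data.List.Relation.Unary.Unique.Propositional using (Unique)
open import Data.List.Membership.Propositional using (_∈_)
open import Relation.Binary.PropositionalEquality using (_≡_)
open import Relation.Nullary using (Dec; yes; no; ¬_)
open import Data.Sum using (inj₁; inj₂)

-- A triple of points; a k=3 block {a,b,c} is represented by the unique
-- increasing triple (a , b , c) with a < b < c.
Triple : ℕ → Set
Triple v = Fin v × Fin v × Fin v

IsBlock : ∀ {v} → Triple v → Set
IsBlock (a , b , c) = a < b × b < c

_∈B_ : ∀ {v} → Fin v → Triple v → Set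
x ∈B (a , b , c) = x ≡ a ⊎ x ≡ b ⊎ x ≡ c

_∈B?_ : ∀ {v} (x : Fin v) (B : Triple v) → Dec (x ∈B B)
x ∈B? (a , b , c) with x ≟ a | x ≟ b | x ≟ c
... | yes p | _ | _ = yes (inj₁ p)
... | no _ | yes q | _ = yes (inj₂ (inj₁ q))
... | no _ | no _ | yes r = yes (inj₂ (inj₂ r))
... | no p | no q | no r = no λ { (inj₁ e) → p e ; (inj₂ (inj₁ e)) → q e ; (inj₂ (inj₂ e)) → r e }

countPt : ∀ {v} → Fin v → List (Triple v) → ℕ
countPt x [] = 0
countPt x (B ∷ Bs) with x ∈B? B
... | yes _ = suc (countPt x Bs)
... | no _ = countPt x Bs

countPair : ∀ {v} → Fin v → Fin v → List (Triple v) → ℕ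
countPair x y [] = 0
countPair x y (B ∷ Bs) with x ∈B? B | y ∈B? B
... | yes _ | yes _ = suc (countPair x y Bs)
... | _ | _ = countPair x y Bs

-- A μ-way (v,3,2) trade of volume m on V = Fin v, given as μ collections
-- (each a duplicate-free list of 3-subsets of V).
record IsTrade (v μ m : ℕ) (T : Fin μ → List (Triple v)) : Set where
  field
    blocks   : ∀ i → All IsBlock (T i)
    distinct : ∀ i → Unique (T i)
    volume   : ∀ i → length (T i) ≡ m
    disjoint : ∀ i j B → B ∈ T i → B ∈ T j → i ≡ j
    balanced : ∀ (x y : Fin v) → x < y → ∀ i j → countPair x y (T i) ≡ countPair x y (T j)

InFound : ∀ {v μ} → (Fin μ → List (Triple v)) → Fin v → Set
InFound T x = ∃[ i ] ∃[ B ] (B ∈ T i × x ∈B B)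

IsSteiner : ∀ {v μ} → (Fin μ → List (Triple v)) → Set
IsSteiner {v} T = ∀ (x y : Fin v) → x < y → InFound T x → InFound T y →
  ∀ i → countPair x y (T i) ≤ 1

IsHomogeneous : ∀ {v μ} → ℕ → (Fin μ → List (Triple v)) → Set
IsHomogeneous {v} d T = ∀ (x : Fin v) i → countPt x (T i) ≡ d

module Submission where

-- The case v = 8 is a single explicit 3-way trade on the
-- points {0,…,7}: three pairwise disjoint collections of eight triples each,
-- in which every pair of points lies in at most one triple of each collection
-- (the same number in all three) and every point lies in exactly three
-- triples.
-- For v = 8n we take n disjoint copies of this trade, the j-th copy living on
-- the points combine a j (a < 8) of Fin (8 * n).

open import Defs
open import Data.Nat using (ℕ; suc; zero; _*_; _+_; _≤_; z≤n)
import Data.Nat.Properties as ℕP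
open import Data.Fin using (Fin; zero; suc; combine; remQuot; #_) renaming (_<_ to _<F_)
import Data.Fin.Properties as FinP
open import Data.Nat.ListAction using (sum)
open import Data.List using (List; []; _∷_; map; _++_; length; cartesianProductWith; allFin; tabulate)
import Data.List.Properties as ListP
open import Data.List.Relation.Unary.All as All using (All)
import Data.List.Relation.Unary.AllPairs as AllPairs
open import Data.List.Relation.Unary.Unique.Propositional using (Unique)
import Data.List.Relation.Unary.Unique.Propositional.Properties as UniqueP
open import Data.List.Membership.Propositional using (_∈_; _∉_)
import Data.List.Membership.Propositional.Properties as MembershipP
open import Data.Product using (_×_; ∃-syntax; _,_; proj₁; proj₂)
open import Data.Product.Properties using (≡-dec)
open import Data.Sum using (_⊎_; inj₁; inj₂)
open import Data.Empty using (⊥-elim)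
open import Data.Unit using (tt)
open import Function using (_∘_)
open import Relation.Binary.PropositionalEquality
open import Relation.Binary.Definitions using (DecidableEquality; tri<; tri≈; tri>)
open import Relation.Nullary using (Dec; yes; no; ¬_)
open import Relation.Nullary.Decidable using (toWitness; _⊎-dec_; _×-dec_; ¬?)

private
  variable
    v : ℕ
    X : Set

Additive : (List (Triple v) → ℕ) → Set
Additive {v} count = count [] ≡ 0 × (∀ (Bs Cs : List (Triple v)) → count (Bs ++ Cs) ≡ count Bs + count Cs)

countPt-additive : (x : Fin v) → Additive (countPt x)
countPt-additive x = refl , go
  where
  go : ∀ Bs Cs → countPt x (Bs ++ Cs) ≡ countPt x Bs + countPt x Cs
  go [] Cs = refl
  go (B ∷ Bs) Cs with x ∈B? B
  ... | yes _ = cong suc (go Bs Cs)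
  ... | no _  = go Bs Cs

countPair-additive : (x y : Fin v) → Additive (countPair x y)
countPair-additive x y = refl , go
  where
  go : ∀ Bs Cs → countPair x y (Bs ++ Cs) ≡ countPair x y Bs + countPair x y Cs
  go [] Cs = refl
  go (B ∷ Bs) Cs with x ∈B? B | y ∈B? B
  ... | yes _ | yes _ = cong suc (go Bs Cs)
  ... | yes _ | no _  = go Bs Cs
  ... | no _  | _     = go Bs Cs

count-cartesian : (count : List (Triple v) → ℕ) → Additive count →
  ∀ {n} (f : Fin n → X → Triple v) (js : List (Fin n)) (Bs : List X) →
  count (cartesianProductWith f js Bs) ≡ sum (map (λ j → count (map (f j) Bs)) js)
count-cartesian count (count[] , _) f [] Bs = count[]
count-cartesian count additive@(_ , count-++) f (j ∷ js) Bs =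
  trans (count-++ (map (f j) Bs) _) (cong (count (map (f j) Bs) +_) (count-cartesian count additive f js Bs))

sum-single : ∀ {n} (F : Fin n → ℕ) (k : Fin n) → (∀ j → j ≢ k → F j ≡ 0) → sum (map F (allFin n)) ≡ F k
sum-single F k vanish = trans (cong sum (ListP.map-tabulate (λ j → j) F)) (sum-tabulate-single F k vanish)
  where
  all-zero : ∀ {n} (F : Fin n → ℕ) → (∀ j → F j ≡ 0) → sum (tabulate F) ≡ 0
  all-zero {zero}  F zero-everywhere = refl
  all-zero {suc n} F zero-everywhere rewrite zero-everywhere zero = all-zero (F ∘ suc) (zero-everywhere ∘ suc)

  sum-tabulate-single : ∀ {n} (F : Fin n → ℕ) (k : Fin n) → (∀ j → j ≢ k → F j ≡ 0) → sum (tabulate F) ≡ F k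
  sum-tabulate-single {suc n} F zero vanish
    rewrite all-zero (F ∘ suc) (λ j → vanish (suc j) (λ ())) = ℕP.+-identityʳ (F zero)
  sum-tabulate-single {suc n} F (suc k) vanish
    rewrite vanish zero (λ ()) = sum-tabulate-single (F ∘ suc) k (λ j j≢k → vanish (suc j) (j≢k ∘ FinP.suc-injective))

countPt-absent : (g : X → Triple v) (x : Fin v) (Bs : List X) →
  (∀ B → ¬ (x ∈B g B)) → countPt x (map g Bs) ≡ 0
countPt-absent g x [] absent = refl
countPt-absent g x (B ∷ Bs) absent with x ∈B? g B
... | yes x∈ = ⊥-elim (absent B x∈)
... | no _   = countPt-absent g x Bs absent

countPair-absent : (g : X → Triple v) (x y : Fin v) (Bs : List X) →
  (∀ B → ¬ (x ∈B g B × y ∈B g B)) → countPair x y (map g Bs) ≡ 0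
countPair-absent g x y [] absent = refl
countPair-absent g x y (B ∷ Bs) absent with x ∈B? g B | y ∈B? g B
... | yes x∈ | yes y∈ = ⊥-elim (absent B (x∈ , y∈))
... | yes _  | no _   = countPair-absent g x y Bs absent
... | no _   | _      = countPair-absent g x y Bs absent

length-cartesian : ∀ {A B C : Set} (f : A → B → C) (xs : List A) (ys : List B) →
  length (cartesianProductWith f xs ys) ≡ length xs * length ys
length-cartesian f [] ys = refl
length-cartesian f (x ∷ xs) ys =
  trans (ListP.length-++ (map (f x) ys)) (cong₂ _+_ (ListP.length-map (f x) ys) (length-cartesian f xs ys))

module Copies (w n : ℕ) where

  copy : Fin n → Triple w → Triple (w * n)
  copy j (a , b , c) = combine a j , combine b j , combine c j

  copies : List (Triple w) → List (Triple (w * n))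
  copies = cartesianProductWith copy (allFin n)

  decompose : (x : Fin (w * n)) → ∃[ a ] ∃[ j ] (combine a j ≡ x)
  decompose x = proj₁ (remQuot {w} n x) , proj₂ (remQuot {w} n x) , FinP.combine-remQuot {w} n x

  combine-cancel-< : ∀ {a b : Fin w} (j : Fin n) → combine a j <F combine b j → a <F b
  combine-cancel-< {a = a} {b} j a<b with FinP.<-cmp a b
  ... | tri< a<b' _ _ = a<b'
  ... | tri≈ _ refl _ = ⊥-elim (FinP.<-irrefl refl a<b)
  ... | tri> _ _ b<a = ⊥-elim (FinP.<-asym a<b (FinP.combine-monoˡ-< j j b<a))

  ∈B-copy⁺ : ∀ {a : Fin w} {j B} → a ∈B B → combine a j ∈B copy j B
  ∈B-copy⁺ (inj₁ refl)        = inj₁ refl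
  ∈B-copy⁺ (inj₂ (inj₁ refl)) = inj₂ (inj₁ refl)
  ∈B-copy⁺ (inj₂ (inj₂ refl)) = inj₂ (inj₂ refl)

  ∈B-copy⁻ : ∀ {a : Fin w} {j j'} B → combine a j ∈B copy j' B → j ≡ j' × a ∈B B
  ∈B-copy⁻ {a = a} {j} {j'} (p , q , r) (inj₁ e) =
    FinP.combine-injectiveʳ a j p j' e , inj₁ (FinP.combine-injectiveˡ a j p j' e)
  ∈B-copy⁻ {a = a} {j} {j'} (p , q , r) (inj₂ (inj₁ e)) =
    FinP.combine-injectiveʳ a j q j' e , inj₂ (inj₁ (FinP.combine-injectiveˡ a j q j' e))
  ∈B-copy⁻ {a = a} {j} {j'} (p , q , r) (inj₂ (inj₂ e)) =
    FinP.combine-injectiveʳ a j r j' e , inj₂ (inj₂ (FinP.combine-injectiveˡ a j r j' e))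

  copy-injective : ∀ {j j'} {B B' : Triple w} → copy j B ≡ copy j' B' → j ≡ j' × B ≡ B'
  copy-injective {j = j} {j'} {a , b , c} {a' , b' , c'} e =
    FinP.combine-injectiveʳ a j a' j' (cong proj₁ e) ,
    cong₂ _,_ (FinP.combine-injectiveˡ a j a' j' (cong proj₁ e))
      (cong₂ _,_ (FinP.combine-injectiveˡ b j b' j' (cong (proj₁ ∘ proj₂) e))
                 (FinP.combine-injectiveˡ c j c' j' (cong (proj₂ ∘ proj₂) e)))

  copy-block : ∀ j {B : Triple w} → IsBlock B → IsBlock (copy j B)
  copy-block j (a<b , b<c) = FinP.combine-monoˡ-< j j a<b , FinP.combine-monoˡ-< j j b<c

  countPt-copy : ∀ (a : Fin w) j Bs → countPt (combine a j) (map (copy j) Bs) ≡ countPt a Bs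
  countPt-copy a j [] = refl
  countPt-copy a j (B ∷ Bs) with combine a j ∈B? copy j B | a ∈B? B
  ... | yes _   | yes _  = cong suc (countPt-copy a j Bs)
  ... | yes a∈' | no a∉  = ⊥-elim (a∉ (proj₂ (∈B-copy⁻ B a∈')))
  ... | no a∉'  | yes a∈ = ⊥-elim (a∉' (∈B-copy⁺ a∈))
  ... | no _    | no _   = countPt-copy a j Bs

  countPair-copy : ∀ (a b : Fin w) j Bs →
    countPair (combine a j) (combine b j) (map (copy j) Bs) ≡ countPair a b Bs
  countPair-copy a b j [] = refl
  countPair-copy a b j (B ∷ Bs)
    with combine a j ∈B? copy j B | combine b j ∈B? copy j B | a ∈B? B | b ∈B? B
  ... | yes _   | yes _   | yes _  | yes _  = cong suc (countPair-copy a b j Bs)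
  ... | yes a∈' | _       | no a∉  | _      = ⊥-elim (a∉ (proj₂ (∈B-copy⁻ B a∈')))
  ... | yes _   | yes b∈' | yes _  | no b∉  = ⊥-elim (b∉ (proj₂ (∈B-copy⁻ B b∈')))
  ... | yes _   | no b∉'  | _      | yes b∈ = ⊥-elim (b∉' (∈B-copy⁺ b∈))
  ... | yes _   | no _    | yes _  | no _   = countPair-copy a b j Bs
  ... | no a∉'  | _       | yes a∈ | _      = ⊥-elim (a∉' (∈B-copy⁺ a∈))
  ... | no _    | _       | no _   | _      = countPair-copy a b j Bs

  -- Over all copies, only the copy containing the point contributes.
  countPt-copies : ∀ (a : Fin w) j Bs → countPt (combine a j) (copies Bs) ≡ countPt a Bs
  countPt-copies a j Bs = begin
    countPt x (copies Bs)                                    ≡⟨ count-cartesian (countPt x) (countPt-additive x) copy (allFin n) Bs ⟩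
    sum (map (λ j' → countPt x (map (copy j') Bs)) (allFin n)) ≡⟨ sum-single _ j other-copies ⟩
    countPt x (map (copy j) Bs)                              ≡⟨ countPt-copy a j Bs ⟩
    countPt a Bs                                             ∎
    where
    open ≡-Reasoning
    x : Fin (w * n)
    x = combine a j
    other-copies : ∀ j' → j' ≢ j → countPt x (map (copy j') Bs) ≡ 0
    other-copies j' j'≢j = countPt-absent (copy j') x Bs λ B x∈ → j'≢j (sym (proj₁ (∈B-copy⁻ B x∈)))

  countPair-copies-same : ∀ (a b : Fin w) j Bs →
    countPair (combine a j) (combine b j) (copies Bs) ≡ countPair a b Bs
  countPair-copies-same a b j Bs = begin
    countPair x y (copies Bs)                                    ≡⟨ count-cartesian (countPair x y) (countPair-additive x y) copy (allFin n) Bs ⟩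
    sum (map (λ j' → countPair x y (map (copy j') Bs)) (allFin n)) ≡⟨ sum-single _ j other-copies ⟩
    countPair x y (map (copy j) Bs)                              ≡⟨ countPair-copy a b j Bs ⟩
    countPair a b Bs                                             ∎
    where
    open ≡-Reasoning
    x : Fin (w * n)
    x = combine a j
    y : Fin (w * n)
    y = combine b j
    other-copies : ∀ j' → j' ≢ j → countPair x y (map (copy j') Bs) ≡ 0
    other-copies j' j'≢j =
      countPair-absent (copy j') x y Bs λ B (x∈ , _) → j'≢j (sym (proj₁ (∈B-copy⁻ B x∈)))

  countPair-copies-different : ∀ (a b : Fin w) {j k} → j ≢ k → ∀ Bs →
    countPair (combine a j) (combine b k) (copies Bs) ≡ 0
  countPair-copies-different a b {j} {k} j≢k Bs =
    trans (count-cartesian (countPair x y) (countPair-additive x y) copy (allFin n) Bs)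
          (trans (cong sum (ListP.map-cong no-block (allFin n))) (sum-zeros (allFin n)))
    where
    x : Fin (w * n)
    x = combine a j
    y : Fin (w * n)
    y = combine b k
    no-block : ∀ j' → countPair x y (map (copy j') Bs) ≡ 0
    no-block j' = countPair-absent (copy j') x y Bs λ B (x∈ , y∈) →
      j≢k (trans (proj₁ (∈B-copy⁻ B x∈)) (sym (proj₁ (∈B-copy⁻ B y∈))))
    sum-zeros : (js : List (Fin n)) → sum (map (λ _ → 0) js) ≡ 0
    sum-zeros []       = refl
    sum-zeros (_ ∷ js) = sum-zeros js

  length-copies : (Bs : List (Triple w)) → length (copies Bs) ≡ length Bs * n
  length-copies Bs = begin
    length (copies Bs)            ≡⟨ length-cartesian copy (allFin n) Bs ⟩
    length (allFin n) * length Bs ≡⟨ cong (_* length Bs) (ListP.length-tabulate {n = n} (λ j → j)) ⟩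
    n * length Bs                 ≡⟨ ℕP.*-comm n (length Bs) ⟩
    length Bs * n                 ∎
    where open ≡-Reasoning

  ∈-copies⁻ : ∀ {Bs : List (Triple w)} {C} → C ∈ copies Bs → ∃[ j ] ∃[ B ] (B ∈ Bs × C ≡ copy j B)
  ∈-copies⁻ {Bs = Bs} C∈ with MembershipP.∈-cartesianProductWith⁻ copy (allFin n) Bs C∈
  ... | j , B , _ , B∈ , C≡ = j , B , B∈ , C≡

  module _ {μ : ℕ} (T : Fin μ → List (Triple w)) where

    copiesOf : Fin μ → List (Triple (w * n))
    copiesOf i = copies (T i)

    found-copies : ∀ a j → InFound copiesOf (combine a j) → InFound T a
    found-copies a j (i , C , C∈ , x∈) with ∈-copies⁻ C∈
    ... | j' , B , B∈ , refl = i , B , B∈ , proj₂ (∈B-copy⁻ B x∈)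

    -- Copies of a trade form a trade: the pair counts are those of the
    -- original for points in one copy, and zero for points in different copies.
    copies-trade : ∀ {m} → IsTrade w μ m T → IsTrade (w * n) μ (m * n) copiesOf
    copies-trade trade = record
      { blocks   = λ i → All.tabulate λ C∈ → blocks-copied i (∈-copies⁻ C∈)
      ; distinct = λ i → UniqueP.cartesianProductWith⁺ copy copy-injective (UniqueP.allFin⁺ n) (distinct i)
      ; volume   = λ i → trans (length-copies (T i)) (cong (_* n) (volume i))
      ; disjoint = disjoint-copied
      ; balanced = balanced-copied
      }
      where
      open IsTrade trade
      blocks-copied : ∀ i {C} → ∃[ j ] ∃[ B ] (B ∈ T i × C ≡ copy j B) → IsBlock C
      blocks-copied i (j , B , B∈ , refl) = copy-block j (All.lookup (blocks i) B∈)

      disjoint-copied : ∀ i k C → C ∈ copiesOf i → C ∈ copiesOf k → i ≡ k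
      disjoint-copied i k C C∈i C∈k with ∈-copies⁻ C∈i | ∈-copies⁻ C∈k
      ... | j , B , B∈i , refl | j' , B' , B'∈k , C≡ with copy-injective {j = j} {j'} {B} {B'} C≡
      ... | refl , refl = disjoint i k B B∈i B'∈k

      balanced-copied : ∀ x y → x <F y → ∀ i k → countPair x y (copiesOf i) ≡ countPair x y (copiesOf k)
      balanced-copied x y x<y i k with decompose x | decompose y
      ... | a , j , refl | b , j' , refl with j FinP.≟ j'
      ... | yes refl = begin
        countPair (combine a j) (combine b j) (copiesOf i) ≡⟨ countPair-copies-same a b j (T i) ⟩
        countPair a b (T i)                               ≡⟨ balanced a b (combine-cancel-< j x<y) i k ⟩
        countPair a b (T k)                               ≡⟨ countPair-copies-same a b j (T k) ⟨
        countPair (combine a j) (combine b j) (copiesOf k) ∎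
        where open ≡-Reasoning
      ... | no j≢j' =
        trans (countPair-copies-different a b j≢j' (T i)) (sym (countPair-copies-different a b j≢j' (T k)))

    copies-steiner : IsSteiner T → IsSteiner copiesOf
    copies-steiner steiner x y x<y x-found y-found i with decompose x | decompose y
    ... | a , j , refl | b , j' , refl with j FinP.≟ j'
    ... | yes refl = subst (_≤ 1) (sym (countPair-copies-same a b j (T i)))
      (steiner a b (combine-cancel-< j x<y) (found-copies a j x-found) (found-copies b j y-found) i)
    ... | no j≢j' = subst (_≤ 1) (sym (countPair-copies-different a b j≢j' (T i))) z≤n

    copies-homogeneous : ∀ {d} → IsHomogeneous d T → IsHomogeneous d copiesOf
    copies-homogeneous homogeneous x i with decompose x
    ... | a , j , refl = trans (countPt-copies a j (T i)) (homogeneous a i)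

base : Fin 3 → List (Triple 8)
base zero = (# 0 , # 2 , # 4) ∷ (# 0 , # 3 , # 6) ∷ (# 0 , # 5 , # 7) ∷ (# 1 , # 2 , # 7) ∷
            (# 1 , # 3 , # 5) ∷ (# 1 , # 4 , # 6) ∷ (# 2 , # 5 , # 6) ∷ (# 3 , # 4 , # 7) ∷ []
base (suc zero) = (# 0 , # 2 , # 5) ∷ (# 0 , # 3 , # 7) ∷ (# 0 , # 4 , # 6) ∷ (# 1 , # 2 , # 6) ∷
            (# 1 , # 3 , # 4) ∷ (# 1 , # 5 , # 7) ∷ (# 2 , # 4 , # 7) ∷ (# 3 , # 5 , # 6) ∷ []
base (suc (suc zero)) = (# 0 , # 2 , # 6) ∷ (# 0 , # 3 , # 5) ∷ (# 0 , # 4 , # 7) ∷ (# 1 , # 2 , # 4) ∷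
            (# 1 , # 3 , # 7) ∷ (# 1 , # 5 , # 6) ∷ (# 2 , # 5 , # 7) ∷ (# 3 , # 4 , # 6) ∷ []

module BaseChecks where
  _≟T_ : DecidableEquality (Triple 8)
  _≟T_ = ≡-dec FinP._≟_ (≡-dec FinP._≟_ FinP._≟_)

  open import Data.List.Membership.DecPropositional _≟T_ using (_∈?_)

  isBlock? : (B : Triple 8) → Dec (IsBlock B)
  isBlock? (a , b , c) = (a FinP.<? b) ×-dec (b FinP.<? c)

  blocks : ∀ i → All IsBlock (base i)
  blocks = toWitness {a? = FinP.all? (λ i → All.all? isBlock? (base i))} tt

  distinct : ∀ i → Unique (base i)
  distinct = toWitness {a? = FinP.all? (λ i → AllPairs.allPairs? (λ B C → ¬? (B ≟T C)) (base i))} tt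

  volume : ∀ i → length (base i) ≡ 8
  volume zero             = refl
  volume (suc zero)       = refl
  volume (suc (suc zero)) = refl

  disjoint : ∀ i k → i ≡ k ⊎ All (λ B → B ∉ base k) (base i)
  disjoint = toWitness {a? = FinP.all? (λ i → FinP.all? (λ k →
    (i FinP.≟ k) ⊎-dec All.all? (λ B → ¬? (B ∈? base k)) (base i)))} tt

  balanced : ∀ i k a b → countPair a b (base i) ≡ countPair a b (base k)
  balanced = toWitness {a? = FinP.all? (λ i → FinP.all? (λ k → FinP.all? (λ a → FinP.all? (λ b →
    countPair a b (base i) ℕP.≟ countPair a b (base k)))))} tt

  steiner : ∀ i a b → a ≡ b ⊎ countPair a b (base i) ≤ 1
  steiner = toWitness {a? = FinP.all? (λ i → FinP.all? (λ a → FinP.all? (λ b →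
    (a FinP.≟ b) ⊎-dec (countPair a b (base i) ℕP.≤? 1))))} tt

  homogeneous : ∀ i a → countPt a (base i) ≡ 3
  homogeneous = toWitness {a? = FinP.all? (λ i → FinP.all? (λ a → countPt a (base i) ℕP.≟ 3))} tt

base-trade : IsTrade 8 3 8 base
base-trade = record
  { blocks   = BaseChecks.blocks
  ; distinct = BaseChecks.distinct
  ; volume   = BaseChecks.volume
  ; disjoint = disjoint
  ; balanced = λ a b _ i k → BaseChecks.balanced i k a b
  }
  where
  disjoint : ∀ i k B → B ∈ base i → B ∈ base k → i ≡ k
  disjoint i k B B∈i B∈k with BaseChecks.disjoint i k
  ... | inj₁ i≡k      = i≡k
  ... | inj₂ B∉base-k = ⊥-elim (All.lookup B∉base-k B∈i B∈k)

base-steiner : IsSteiner base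
base-steiner a b a<b _ _ i with BaseChecks.steiner i a b
... | inj₁ refl = ⊥-elim (FinP.<-irrefl refl a<b)
... | inj₂ at-most-one = at-most-one

base-homogeneous : IsHomogeneous 3 base
base-homogeneous a i = BaseChecks.homogeneous i a

lemma2p2 : ∀ (ℓ : ℕ) → ∃[ T ] (IsTrade (8 * suc ℓ) 3 (8 * suc ℓ) T
    × IsSteiner T × IsHomogeneous 3 T)
lemma2p2 ℓ = copiesOf base
           , copies-trade base base-trade
           , copies-steiner base base-steiner
           , copies-homogeneous base base-homogeneous
  where open Copies 8 (suc ℓ)
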